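{- Every finite simple cactus graph $G$ with at least two vertices has a complete conflict-free coloring with $3$ colors, i.e. a map $C:V(G)\to\{1,2,3\}$ such that every $v\in V(G)$ has a color appearing exactly once in $N(v)$. Moreover, there exists a cactus graph $G$ with $\chi_{CF}(G)=3$.
   Context: A cactus graph is a connected graph in which any two cycles have at most one vertex in common. $N(v)$ is the open neighborhood of $v$; $\chi_{CF}(G)$ is the minimum number of colors in a complete conflict-free coloring of $G$ (every vertex colored, each vertex has a color occurring exactly once in its open neighborhood). -}

module Defs where

open import Data.Nat using (ℕ; zero; suc; _<_; _≤_)
open import Data.Nat.DivMod using (_%_; m%n<n)
open import Data.Fin using (Fin; toℕ; fromℕ<)
open import Data.Bool using (Bool; true; false)
open import Data.Product using (Σ; ∃; ∃-syntax; _×_; _,_)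
open import Data.Sum using (_⊎_)
open import Relation.Binary.PropositionalEquality using (_≡_; _≢_)
open import Relation.Nullary using (¬_)

record Graph (n : ℕ) : Set where
  field
    adj   : Fin n → Fin n → Bool
    sym   : ∀ u v → adj u v ≡ adj v u
    irref : ∀ v → adj v v ≡ false

open Graph public

Adj : ∀ {n} → Graph n → Fin n → Fin n → Set
Adj G u v = adj G u v ≡ true

data Walk {n : ℕ} (G : Graph n) : Fin n → Fin n → Set where
  here : ∀ {u} → Walk G u u
  step : ∀ {u w v} → Adj G u w → Walk G w v → Walk G u v

Connected : ∀ {n} → Graph n → Set
Connected G = ∀ u v → Walk G u v

next : ∀ {k} → Fin (suc k) → Fin (suc k)
next {k} i = fromℕ< (m%n<n (suc (toℕ i)) (suc k))

-- A cycle of length m+3 ≥ 3: an injective cyclic sequence of vertices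
-- with consecutive entries adjacent (including last–first).
record Cycle {n : ℕ} (G : Graph n) : Set where
  field
    len   : ℕ
    vert  : Fin (suc (suc (suc len))) → Fin n
    inj   : ∀ i j → vert i ≡ vert j → i ≡ j
    edges : ∀ i → Adj G (vert i) (vert (next i))

open Cycle public

OnCycle : ∀ {n} {G : Graph n} → Fin n → Cycle G → Set
OnCycle v C = ∃[ i ] vert C i ≡ v

CycleEdge : ∀ {n} {G : Graph n} → Cycle G → Fin n → Fin n → Set
CycleEdge C u v = ∃[ i ] ((vert C i ≡ u × vert C (next i) ≡ v)
                        ⊎ (vert C i ≡ v × vert C (next i) ≡ u))

-- Two cycles are the same cycle (as subgraphs) iff they have the same edge set
SameCycle : ∀ {n} {G : Graph n} → Cycle G → Cycle G → Set
SameCycle C D = ∀ u v → (CycleEdge C u v → CycleEdge D u v) × (CycleEdge D u v → CycleEdge C u v)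

Cactus : ∀ {n} → Graph n → Set
Cactus G = Connected G ×
  (∀ (C D : Cycle G) → ¬ SameCycle C D →
     ∀ u v → OnCycle u C → OnCycle u D → OnCycle v C → OnCycle v D → u ≡ v)

IsCFColoring : ∀ {n} (G : Graph n) {k : ℕ} → (Fin n → Fin k) → Set
IsCFColoring {n} G {k} c =
  ∀ v → ∃[ col ] ∃[ u ] (Adj G v u × c u ≡ col ×
          (∀ w → Adj G v w → c w ≡ col → w ≡ u))

CFColorable : ∀ {n} → Graph n → ℕ → Set
CFColorable {n} G k = ∃[ c ] IsCFColoring G {k} c

χCF≡ : ∀ {n} → Graph n → ℕ → Set
χCF≡ G k = CFColorable G k × (∀ j → j < k → ¬ CFColorable G j)

-- Root a BFS tree of the cactus at r and fix a vertex x₁ at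
-- depth 1.  Give every vertex v a designated neighbour d v (its parent, or
-- x₁ for r); it suffices that d v's colour differs from the colours of the
-- other neighbours of v.  Call z and w conflicting when z is a neighbour
-- other than d v of some v with w = d v.  Ordering vertices by depth, every
-- vertex y has at most two earlier conflicting vertices: its grandparent and
-- one more, which is determined by a non-tree edge whose fundamental cycle
-- passes through the tree edge y–parent y.  In a cactus that cycle is unique,
-- because two cycles sharing two vertices coincide.  A greedy colouring in
-- this order then uses only three colours.
module Submission where

open import Defs hiding (sym)
open import Data.Nat using (ℕ; zero; suc; _+_; _*_; _∸_; _≤_; _<_; z≤n; s≤s; s≤s⁻¹; _≤?_; _<?_; _%_)
open import Data.Nat.Properties
open import Data.Nat.DivMod using (m<n⇒m%n≡m; n%n≡0; m%n<n)
open import Data.Fin using (Fin; toℕ; fromℕ<) renaming (zero to fz; suc to fs)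
open import Data.Fin.Properties using (all?; any?; pigeonhole; toℕ-injective; toℕ<n; toℕ-fromℕ<)
  renaming (_≟_ to _≟F_)
open import Data.Bool using (true; false; not)
open import Data.Bool.Properties using () renaming (_≟_ to _≟B_)
open import Data.Maybe using (Maybe; just; nothing)
open import Data.Product using (Σ; ∃-syntax; _×_; _,_; proj₁; proj₂)
open import Data.Sum using (_⊎_; inj₁; inj₂; map₂)
open import Data.Empty using (⊥; ⊥-elim)
open import Data.Unit using (tt)
open import Function using (_∘_)
open import Relation.Nullary using (¬_; Dec; yes; no; ¬?; does)
open import Relation.Nullary.Decidable using (_×-dec_; _⊎-dec_; _→-dec_; toWitness)
open import Relation.Binary using (tri<; tri≈; tri>)
open import Relation.Binary.PropositionalEquality

module LeastWitness (P : ℕ → Set) (P? : ∀ k → Dec (P k)) where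

  scan : ∀ L → (∀ j → j < L → ¬ P j) ⊎ (∃[ k ] (k < L × P k × (∀ j → j < k → ¬ P j)))
  scan zero = inj₁ (λ j ())
  scan (suc L) with scan L
  ... | inj₂ (k , k<L , pk , below) = inj₂ (k , m<n⇒m<1+n k<L , pk , below)
  ... | inj₁ none with P? L
  ...   | yes pL = inj₂ (L , n<1+n L , pL , none)
  ...   | no ¬pL = inj₁ noneUpToL
    where
    noneUpToL : ∀ j → j < suc L → ¬ P j
    noneUpToL j j<1+L with m≤n⇒m<n∨m≡n (s≤s⁻¹ j<1+L)
    ... | inj₁ j<L = none j j<L
    ... | inj₂ refl = ¬pL

  least : ∀ L → P L → ∃[ k ] (P k × (∀ j → j < k → ¬ P j))
  least L pL with scan (suc L)
  ... | inj₁ none = ⊥-elim (none L (n<1+n L) pL)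
  ... | inj₂ (k , _ , pk , below) = k , pk , below

  least≤ : ∀ {k j} → (∀ i → i < k → ¬ P i) → P j → k ≤ j
  least≤ {k} {j} below pj with k ≤? j
  ... | yes k≤j = k≤j
  ... | no k≰j = ⊥-elim (below j (≰⇒> k≰j) pj)

third : Fin 3 → Fin 3 → Fin 3
third fz (fs fz) = fs (fs fz)
third (fs fz) fz = fs (fs fz)
third fz _ = fs fz
third _ fz = fs fz
third _ _ = fz

third-avoids : ∀ a b → third a b ≢ a × third a b ≢ b
third-avoids = toWitness {a? = all? λ a → all? λ b → ¬? (third a b ≟F a) ×-dec ¬? (third a b ≟F b)} tt

avoid : Maybe (Fin 3) → Maybe (Fin 3) → Fin 3
avoid (just a) (just b) = third a b
avoid (just a) nothing = third a a
avoid nothing (just b) = third b b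
avoid nothing nothing = fz

avoid-left : ∀ a m → avoid (just a) m ≢ a
avoid-left a (just b) = proj₁ (third-avoids a b)
avoid-left a nothing = proj₁ (third-avoids a a)

avoid-right : ∀ b m → avoid m (just b) ≢ b
avoid-right b (just a) = proj₂ (third-avoids a b)
avoid-right b nothing = proj₂ (third-avoids b b)

-- The colouring is defined by recursion on a fuel parameter, and
-- `stable` shows that any fuel exceeding the rank gives the same colour.
module Greedy {n : ℕ} (rk : Fin n → ℕ) (A B : Fin n → Fin n) where

  earlier : Fin n → Fin n → Fin 3 → Maybe (Fin 3)
  earlier z y a with rk z <? rk y
  ... | yes _ = just a
  ... | no _ = nothing

  colourWith : ℕ → Fin n → Fin 3
  colourWith zero y = fz
  colourWith (suc k) y = avoid (earlier (A y) y (colourWith k (A y)))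
                               (earlier (B y) y (colourWith k (B y)))

  colour : Fin n → Fin 3
  colour y = colourWith (suc (rk y)) y

  earlier-cong : ∀ z y a b → (rk z < rk y → a ≡ b) → earlier z y a ≡ earlier z y b
  earlier-cong z y a b a≡b with rk z <? rk y
  ... | yes lt = cong just (a≡b lt)
  ... | no _ = refl

  earlier-yes : ∀ z y a → rk z < rk y → earlier z y a ≡ just a
  earlier-yes z y a lt with rk z <? rk y
  ... | yes _ = refl
  ... | no ¬lt = ⊥-elim (¬lt lt)

  -- (m bounds the fuel and makes the induction structural)
  stable : ∀ m k y → rk y < k → k ≤ m → colourWith k y ≡ colour y
  stable (suc m) (suc k) y rk<k (s≤s k≤m) =
    cong₂ avoid (earlier-cong (A y) y _ _ (agree (A y))) (earlier-cong (B y) y _ _ (agree (B y)))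
    where
    agree : ∀ z → rk z < rk y → colourWith k z ≡ colourWith (rk y) z
    agree z lt = trans (stable m k z (<-≤-trans lt (s≤s⁻¹ rk<k)) k≤m)
                       (sym (stable m (rk y) z lt (≤-trans (s≤s⁻¹ rk<k) k≤m)))

  colour-unfold : ∀ y → colour y ≡ avoid (earlier (A y) y (colour (A y))) (earlier (B y) y (colour (B y)))
  colour-unfold y = cong₂ avoid (earlier-cong (A y) y _ _ (λ lt → stable (rk y) (rk y) (A y) lt ≤-refl))
                                (earlier-cong (B y) y _ _ (λ lt → stable (rk y) (rk y) (B y) lt ≤-refl))

  proper : ∀ y z → rk z < rk y → (z ≡ A y ⊎ z ≡ B y) → colour z ≢ colour y
  proper y z lt (inj₁ refl) eq = avoid-left (colour z) mB (begin
      avoid (just (colour z)) mB                    ≡⟨ cong (λ m → avoid m mB) (earlier-yes z y _ lt) ⟨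
      avoid (earlier z y (colour z)) mB             ≡⟨ colour-unfold y ⟨
      colour y                                      ≡⟨ eq ⟨
      colour z                                      ∎)
    where
    open ≡-Reasoning
    mB : Maybe (Fin 3)
    mB = earlier (B y) y (colour (B y))
  proper y z lt (inj₂ refl) eq = avoid-right (colour z) mA (begin
      avoid mA (just (colour z))                    ≡⟨ cong (avoid mA) (earlier-yes z y _ lt) ⟨
      avoid mA (earlier z y (colour z))             ≡⟨ colour-unfold y ⟨
      colour y                                      ≡⟨ eq ⟨
      colour z                                      ∎)
    where
    open ≡-Reasoning
    mA : Maybe (Fin 3)
    mA = earlier (A y) y (colour (A y))

Pair : ∀ {n} → Fin n → Fin n → Fin n → Fin n → Set
Pair a b u v = (a ≡ u × b ≡ v) ⊎ (a ≡ v × b ≡ u)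

Pair? : ∀ {n} (a b u v : Fin n) → Dec (Pair a b u v)
Pair? a b u v = ((a ≟F u) ×-dec (b ≟F v)) ⊎-dec ((a ≟F v) ×-dec (b ≟F u))

Pair-sym : ∀ {n} {a b u v : Fin n} → Pair a b u v → Pair u v a b
Pair-sym (inj₁ (p , q)) = inj₁ (sym p , sym q)
Pair-sym (inj₂ (p , q)) = inj₂ (sym q , sym p)

Pair-swap : ∀ {n} {a b u v : Fin n} → Pair a b u v → Pair b a u v
Pair-swap (inj₁ (p , q)) = inj₂ (q , p)
Pair-swap (inj₂ (p , q)) = inj₁ (q , p)

next-cases : ∀ {k} (i : Fin (suc k)) →
  (suc (toℕ i) < suc k × toℕ (next i) ≡ suc (toℕ i)) ⊎ (toℕ i ≡ k × toℕ (next i) ≡ 0)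
next-cases {k} i with m≤n⇒m<n∨m≡n (toℕ<n i)
... | inj₁ lt = inj₁ (lt , trans (toℕ-fromℕ< (m%n<n (suc (toℕ i)) (suc k))) (m<n⇒m%n≡m lt))
... | inj₂ eq = inj₂ (suc-injective eq ,
  trans (toℕ-fromℕ< (m%n<n (suc (toℕ i)) (suc k))) (trans (cong (_% suc k) eq) (n%n≡0 (suc k))))

module CycleOfSequence {n : ℕ} (G : Graph n) (L : ℕ) (f : ℕ → Fin n)
  (f-inj : ∀ i j → i < suc (suc (suc L)) → j < suc (suc (suc L)) → f i ≡ f j → i ≡ j)
  (f-adj : ∀ i → i < suc (suc L) → Adj G (f i) (f (suc i)))
  (f-close : Adj G (f (suc (suc L))) (f 0)) where

  cycle : Cycle G
  cycle = record { len = L ; vert = λ i → f (toℕ i)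
                 ; inj = λ i j e → toℕ-injective (f-inj (toℕ i) (toℕ j) (toℕ<n i) (toℕ<n j) e)
                 ; edges = edges′ }
    where
    edges′ : ∀ i → Adj G (f (toℕ i)) (f (toℕ (next i)))
    edges′ i with next-cases i
    ... | inj₁ (lt , e) rewrite e = f-adj (toℕ i) (s≤s⁻¹ lt)
    ... | inj₂ (e₁ , e₂) rewrite e₁ | e₂ = f-close

  on-cycle : ∀ i → i < suc (suc (suc L)) → OnCycle (f i) cycle
  on-cycle i lt = fromℕ< lt , cong f (toℕ-fromℕ< lt)

  step-edge : ∀ i → i < suc (suc L) → CycleEdge cycle (f i) (f (suc i))
  step-edge i lt = fromℕ< i<L+3 , inj₁ (cong f (toℕ-fromℕ< i<L+3) , cong f next-i)
    where
    i<L+3 : i < suc (suc (suc L))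
    i<L+3 = m<n⇒m<1+n lt
    next-i : toℕ (next (fromℕ< i<L+3)) ≡ suc i
    next-i with next-cases (fromℕ< i<L+3)
    ... | inj₁ (_ , e) = trans e (cong suc (toℕ-fromℕ< i<L+3))
    ... | inj₂ (e₁ , _) = ⊥-elim (<-irrefl (trans (sym (toℕ-fromℕ< i<L+3)) e₁) lt)

  closing-edge : CycleEdge cycle (f (suc (suc L))) (f 0)
  closing-edge = fromℕ< last<L+3 , inj₁ (cong f (toℕ-fromℕ< last<L+3) , cong f next-last)
    where
    last<L+3 : suc (suc L) < suc (suc (suc L))
    last<L+3 = n<1+n (suc (suc L))
    next-last : toℕ (next (fromℕ< last<L+3)) ≡ 0
    next-last with next-cases (fromℕ< last<L+3)
    ... | inj₁ (lt , _) = ⊥-elim (<-irrefl (cong suc (toℕ-fromℕ< last<L+3)) lt)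
    ... | inj₂ (_ , e) = e

  edge-cases : ∀ u v → CycleEdge cycle u v →
    (∃[ i ] (i < suc (suc L) × Pair (f i) (f (suc i)) u v)) ⊎ Pair (f (suc (suc L))) (f 0) u v
  edge-cases u v (i , p) with next-cases i
  ... | inj₁ (lt , e) rewrite e = inj₁ (toℕ i , s≤s⁻¹ lt , p)
  ... | inj₂ (e₁ , e₂) rewrite e₁ | e₂ = inj₂ p

n≢2+n : ∀ {m} → m ≢ suc (suc m)
n≢2+n ()

Adj? : ∀ {n} (G : Graph n) u v → Dec (Adj G u v)
Adj? G u v = adj G u v ≟B true

adj-sym : ∀ {n} (G : Graph n) {u v} → Adj G u v → Adj G v u
adj-sym G {u} {v} a = trans (Graph.sym G v u) a

adj-irrefl : ∀ {n} (G : Graph n) {u v} → Adj G u v → u ≢ v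
adj-irrefl G {u} a refl with trans (sym a) (irref G u)
... | ()

module BFSTree {n : ℕ} (G : Graph n) (conn : Connected G) (r : Fin n) where

  Within : ℕ → Fin n → Set
  Within zero v = v ≡ r
  Within (suc k) v = Within k v ⊎ ∃[ u ] (Adj G v u × Within k u)

  Within? : ∀ k v → Dec (Within k v)
  Within? zero v = v ≟F r
  Within? (suc k) v = Within? k v ⊎-dec any? (λ u → Adj? G v u ×-dec Within? k u)

  walk-length : ∀ {u v} → Walk G u v → ℕ
  walk-length here = 0
  walk-length (step _ w) = suc (walk-length w)

  walk-within : ∀ {v} (w : Walk G v r) → Within (walk-length w) v
  walk-within here = refl
  walk-within (step {w = u} a w) = inj₂ (u , a , walk-within w)

  -- Depth and parent are kept abstract so that later proofs never unfold
  -- the search that computes them.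
  abstract
    private
      shortest : (v : Fin n) → ∃[ k ] (Within k v × (∀ j → j < k → ¬ Within j v))
      shortest v = LeastWitness.least (λ k → Within k v) (λ k → Within? k v)
                     (walk-length (conn v r)) (walk-within (conn v r))

    depth : Fin n → ℕ
    depth v = proj₁ (shortest v)

    depth-within : ∀ v → Within (depth v) v
    depth-within v = proj₁ (proj₂ (shortest v))

    depth-minimal : ∀ {v j} → Within j v → depth v ≤ j
    depth-minimal {v} = LeastWitness.least≤ (λ k → Within k v) (λ k → Within? k v) (proj₂ (proj₂ (shortest v)))

    depth-adj : ∀ {u w} → Adj G u w → depth w ≤ suc (depth u)
    depth-adj {u} a = depth-minimal (inj₂ (u , adj-sym G a , depth-within u))

    depth-root : depth r ≡ 0
    depth-root = n≤0⇒n≡0 (depth-minimal {r} {0} refl)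

    depth0⇒root : ∀ {v} → depth v ≡ 0 → v ≡ r
    depth0⇒root {v} e = subst (λ k → Within k v) e (depth-within v)

    CloserNeighbour : Fin n → Set
    CloserNeighbour v = ∃[ u ] (Adj G v u × suc (depth u) ≡ depth v)

    closer-neighbour : ∀ {v} → v ≢ r → CloserNeighbour v
    closer-neighbour {v} v≢r with depth v in eq | depth-within v | depth-minimal {v}
    ... | zero | _ | _ = ⊥-elim (v≢r (depth0⇒root eq))
    ... | suc k | inj₁ within-k | minimal = ⊥-elim (<-irrefl refl (minimal within-k))
    ... | suc k | inj₂ (u , a , within-k) | _ = u , a , cong suc (≤-antisym (depth-minimal within-k) (s≤s⁻¹ sk≤su))
      where
      sk≤su : suc k ≤ suc (depth u)
      sk≤su = subst (_≤ suc (depth u)) eq (depth-adj (adj-sym G a))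

    parentOf : ∀ v → Dec (CloserNeighbour v) → Fin n
    parentOf v (yes (u , _)) = u
    parentOf v (no _) = v

    -- the root is its own parent
    parent : Fin n → Fin n
    parent v = parentOf v (any? (λ u → Adj? G v u ×-dec (suc (depth u) ≟ depth v)))

    parent-spec : ∀ {v} → v ≢ r → Adj G v (parent v) × suc (depth (parent v)) ≡ depth v
    parent-spec {v} = spec (any? (λ u → Adj? G v u ×-dec (suc (depth u) ≟ depth v)))
      where
      spec : (d : Dec (CloserNeighbour v)) → v ≢ r → Adj G v (parentOf v d) × suc (depth (parentOf v d)) ≡ depth v
      spec (yes (_ , p)) _ = p
      spec (no ¬p) v≢r = ⊥-elim (¬p (closer-neighbour v≢r))

    parent-root : parent r ≡ r
    parent-root with any? (λ u → Adj? G r u ×-dec (suc (depth u) ≟ depth r))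
    ... | yes (_ , _ , e) = ⊥-elim (1+n≢0 (trans e depth-root))
    ... | no _ = refl

  nonroot⇒depth>0 : ∀ {v} → v ≢ r → 0 < depth v
  nonroot⇒depth>0 {v} v≢r with depth v in eq
  ... | zero = ⊥-elim (v≢r (depth0⇒root eq))
  ... | suc _ = s≤s z≤n

  depth>0⇒nonroot : ∀ {v} → 0 < depth v → v ≢ r
  depth>0⇒nonroot lt refl = <-irrefl (sym depth-root) lt

  parent-adj : ∀ {v} → v ≢ r → Adj G v (parent v)
  parent-adj v≢r = proj₁ (parent-spec v≢r)

  depth-parent : ∀ v → depth (parent v) ≡ depth v ∸ 1
  depth-parent v with v ≟F r
  ... | yes refl = trans (cong depth parent-root) (trans depth-root (sym (cong (_∸ 1) depth-root)))
  ... | no v≢r = cong (_∸ 1) (proj₂ (parent-spec v≢r))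

  nonroot⇒≢parent : ∀ {v} → v ≢ r → v ≢ parent v
  nonroot⇒≢parent {v} v≢r v≡pv = 1+n≢n (trans (cong (λ u → suc (depth u)) v≡pv) (proj₂ (parent-spec v≢r)))

  depth1⇒parent-root : ∀ {v} → depth v ≡ 1 → parent v ≡ r
  depth1⇒parent-root {v} e = depth0⇒root (trans (depth-parent v) (cong (_∸ 1) e))

  root-neighbour-depth : ∀ {v} → Adj G r v → depth v ≡ 1
  root-neighbour-depth {v} a = ≤-antisym (subst (λ d → depth v ≤ suc d) depth-root (depth-adj a))
                                         (nonroot⇒depth>0 (λ v≡r → adj-irrefl G a (sym v≡r)))

  ancestor : ℕ → Fin n → Fin n
  ancestor zero v = v
  ancestor (suc i) v = parent (ancestor i v)

  depth-ancestor : ∀ i v → depth (ancestor i v) ≡ depth v ∸ i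
  depth-ancestor zero v = refl
  depth-ancestor (suc i) v = begin
    depth (parent (ancestor i v))  ≡⟨ depth-parent (ancestor i v) ⟩
    depth (ancestor i v) ∸ 1       ≡⟨ cong (_∸ 1) (depth-ancestor i v) ⟩
    depth v ∸ i ∸ 1                ≡⟨ ∸-+-assoc (depth v) i 1 ⟩
    depth v ∸ (i + 1)              ≡⟨ cong (depth v ∸_) (+-comm i 1) ⟩
    depth v ∸ suc i                ∎
    where open ≡-Reasoning

  ancestor-adj : ∀ {i v} → i < depth v → Adj G (ancestor i v) (ancestor (suc i) v)
  ancestor-adj {i} {v} lt = parent-adj (depth>0⇒nonroot (subst (0 <_) (sym (depth-ancestor i v)) (m<n⇒0<n∸m lt)))

  ancestor-depth : ∀ v → ancestor (depth v) v ≡ r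
  ancestor-depth v = depth0⇒root (trans (depth-ancestor (depth v) v) (n∸n≡0 (depth v)))

CactusCycles : ∀ {n} → Graph n → Set
CactusCycles G = ∀ (C D : Cycle G) → ¬ SameCycle C D →
  ∀ u v → OnCycle u C → OnCycle u D → OnCycle v C → OnCycle v D → u ≡ v

-- Every edge s–t that is not a tree
-- edge closes a cycle whose other edges all belong to the tree: go up from
-- s and from t to the point where their ancestor chains meet.
module FundamentalCycles {n : ℕ} (G : Graph n) (conn : Connected G) (r : Fin n) where
  open BFSTree G conn r

  TreeEdge : Fin n → Fin n → Set
  TreeEdge a b = b ≡ parent a ⊎ a ≡ parent b

  TreeEdge-pair : ∀ {a b u v} → Pair a b u v → TreeEdge a b → TreeEdge u v
  TreeEdge-pair (inj₁ (refl , refl)) te = te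
  TreeEdge-pair (inj₂ (refl , refl)) (inj₁ e) = inj₂ e
  TreeEdge-pair (inj₂ (refl , refl)) (inj₂ e) = inj₁ e

  NonTreeEdge : Fin n → Fin n → Set
  NonTreeEdge s t = Adj G s t × s ≢ parent t × t ≢ parent s

  record FundamentalCycle (s t : Fin n) : Set where
    field
      cycle : Cycle G
      on-s : OnCycle s cycle
      on-t : OnCycle t cycle
      on-parent-s : OnCycle (parent s) cycle
      on-parent-t : OnCycle (parent t) cycle
      on-grandparent-s : depth s ≡ suc (depth t) → OnCycle (parent (parent s)) cycle
      on-grandparent-t : depth t ≡ suc (depth s) → OnCycle (parent (parent t)) cycle
      edge-st : CycleEdge cycle s t
      edges-tree-or-st : ∀ u v → CycleEdge cycle u v → TreeEdge u v ⊎ Pair s t u v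

  flip : ∀ {s t} → FundamentalCycle s t → FundamentalCycle t s
  flip F = record
    { cycle = cycle ; on-s = on-t ; on-t = on-s ; on-parent-s = on-parent-t ; on-parent-t = on-parent-s
    ; on-grandparent-s = on-grandparent-t ; on-grandparent-t = on-grandparent-s
    ; edge-st = swap-edge edge-st
    ; edges-tree-or-st = λ u v e → map₂ Pair-swap (edges-tree-or-st u v e) }
    where
    open FundamentalCycle F
    swap-edge : ∀ {a b} → CycleEdge cycle a b → CycleEdge cycle b a
    swap-edge (i , inj₁ p) = i , inj₂ p
    swap-edge (i , inj₂ p) = i , inj₁ p

  chains-reach-root : ∀ x y → depth x ≡ depth y → ancestor (depth x) x ≡ ancestor (depth x) y
  chains-reach-root x y dx≡dy = trans (ancestor-depth x) (sym (subst (λ d → ancestor d y ≡ r) (sym dx≡dy) (ancestor-depth y)))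

  chains-meet : ∀ x y → depth x ≡ depth y → x ≢ y →
    ∃[ k ] (ancestor (suc k) x ≡ ancestor (suc k) y × (∀ i → i < suc k → ancestor i x ≢ ancestor i y)
            × suc k ≤ depth x)
  chains-meet x y dx≡dy x≢y with LeastWitness.least Meet Meet? (depth x) (chains-reach-root x y dx≡dy)
    where
    Meet : ℕ → Set
    Meet i = ancestor i x ≡ ancestor i y
    Meet? : ∀ i → Dec (Meet i)
    Meet? i = ancestor i x ≟F ancestor i y
  ... | zero , meet , _ = ⊥-elim (x≢y meet)
  ... | suc k , meet , below = k , meet , below ,
        LeastWitness.least≤ (λ i → ancestor i x ≡ ancestor i y) (λ i → ancestor i x ≟F ancestor i y) below
          (chains-reach-root x y dx≡dy)

  -- The tree path x = p 0, p 1, …, p K, …, p T = y (T = 2K) climbing from x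
  -- to the meeting point and descending to y, followed by the constant
  -- `tail` (used to append one extra vertex after y).
  module TreePath (x y tail : Fin n) (D : ℕ) (dx : depth x ≡ D) (dy : depth y ≡ D) (k : ℕ)
                  (meet : ancestor (suc k) x ≡ ancestor (suc k) y)
                  (apart : ∀ i → i < suc k → ancestor i x ≢ ancestor i y)
                  (K≤D : suc k ≤ D) where
    K T : ℕ
    K = suc k
    T = suc (suc (k + k))

    T≡K+K : T ≡ K + K
    T≡K+K = cong suc (sym (+-suc k k))

    K≤T : K ≤ T
    K≤T = subst (K ≤_) (sym T≡K+K) (m≤m+n K K)

    T∸K : T ∸ K ≡ K
    T∸K = trans (cong (_∸ K) T≡K+K) (m+n∸n≡m K K)

    p : ℕ → Fin n
    p i with i ≤? K
    ... | yes _ = ancestor i x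
    ... | no _ with i ≤? T
    ...   | yes _ = ancestor (T ∸ i) y
    ...   | no _ = tail

    p-up : ∀ {i} → i ≤ K → p i ≡ ancestor i x
    p-up {i} i≤K with i ≤? K
    ... | yes _ = refl
    ... | no i≰K = ⊥-elim (i≰K i≤K)

    p-down′ : ∀ {i} → K < i → i ≤ T → p i ≡ ancestor (T ∸ i) y
    p-down′ {i} K<i i≤T with i ≤? K
    ... | yes i≤K = ⊥-elim (<-irrefl refl (<-≤-trans K<i i≤K))
    ... | no _ with i ≤? T
    ...   | yes _ = refl
    ...   | no i≰T = ⊥-elim (i≰T i≤T)

    p-tail : ∀ {i} → T < i → p i ≡ tail
    p-tail {i} T<i with i ≤? K
    ... | yes i≤K = ⊥-elim (<-irrefl refl (<-≤-trans T<i (≤-trans i≤K K≤T)))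
    ... | no _ with i ≤? T
    ...   | yes i≤T = ⊥-elim (<-irrefl refl (<-≤-trans T<i i≤T))
    ...   | no _ = refl

    p-down : ∀ {m} → m ≤ K → p (T ∸ m) ≡ ancestor m y
    p-down {m} m≤K with m <? K
    ... | yes m<K = trans (p-down′ K<T∸m (m∸n≤m T m)) (cong (λ j → ancestor j y) (m∸[m∸n]≡n (≤-trans m≤K K≤T)))
      where
      K<T∸m : K < T ∸ m
      K<T∸m = subst (_< T ∸ m) T∸K (∸-monoʳ-< m<K K≤T)
    ... | no m≮K with ≤-antisym m≤K (≮⇒≥ m≮K)
    ...   | refl = trans (cong p T∸K) (trans (p-up ≤-refl) meet)

    depth-up : ∀ i → depth (ancestor i x) ≡ D ∸ i
    depth-up i = trans (depth-ancestor i x) (cong (_∸ i) dx)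

    depth-down : ∀ i → depth (ancestor i y) ≡ D ∸ i
    depth-down i = trans (depth-ancestor i y) (cong (_∸ i) dy)

    data Position (i : ℕ) : Set where
      ascending  : i ≤ K → Position i
      descending : ∀ m → m < K → i ≡ T ∸ m → Position i

    position : ∀ i → i ≤ T → Position i
    position i i≤T with i ≤? K
    ... | yes i≤K = ascending i≤K
    ... | no i≰K = descending (T ∸ i) (subst (T ∸ i <_) T∸K (∸-monoʳ-< (≰⇒> i≰K) i≤T)) (sym (m∸[m∸n]≡n i≤T))

    level-inj : ∀ {i j} → i ≤ K → j ≤ K → D ∸ i ≡ D ∸ j → i ≡ j
    level-inj i≤K j≤K = ∸-cancelˡ-≡ (≤-trans i≤K K≤D) (≤-trans j≤K K≤D)

    -- The path is injective: on each half by depth, and across the halves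
    -- because the chains are apart below level K.
    p-inj : ∀ i j → i ≤ T → j ≤ T → p i ≡ p j → i ≡ j
    p-inj i j i≤T j≤T e with position i i≤T | position j j≤T
    ... | ascending i≤K | ascending j≤K = level-inj i≤K j≤K
          (trans (sym (depth-up i)) (trans (cong depth (trans (sym (p-up i≤K)) (trans e (p-up j≤K)))) (depth-up j)))
    ... | ascending i≤K | descending m m<K refl = ⊥-elim (apart m m<K (subst (λ l → ancestor l x ≡ ancestor m y) i≡m cross))
      where
      cross : ancestor i x ≡ ancestor m y
      cross = trans (sym (p-up i≤K)) (trans e (p-down (<⇒≤ m<K)))
      i≡m : i ≡ m
      i≡m = level-inj i≤K (<⇒≤ m<K) (trans (sym (depth-up i)) (trans (cong depth cross) (depth-down m)))
    ... | descending m m<K refl | ascending j≤K = ⊥-elim (apart m m<K (sym (subst (λ l → ancestor m y ≡ ancestor l x) (sym m≡j) cross)))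
      where
      cross : ancestor m y ≡ ancestor j x
      cross = trans (sym (p-down (<⇒≤ m<K))) (trans e (p-up j≤K))
      m≡j : m ≡ j
      m≡j = level-inj (<⇒≤ m<K) j≤K (trans (sym (depth-down m)) (trans (cong depth cross) (depth-up j)))
    ... | descending m₁ m₁<K refl | descending m₂ m₂<K refl = cong (T ∸_) (level-inj (<⇒≤ m₁<K) (<⇒≤ m₂<K)
          (trans (sym (depth-down m₁))
            (trans (cong depth (trans (sym (p-down (<⇒≤ m₁<K))) (trans e (p-down (<⇒≤ m₂<K))))) (depth-down m₂))))

    p-step : ∀ i → i < T → Adj G (p i) (p (suc i)) × TreeEdge (p i) (p (suc i))
    p-step i i<T = by-half (suc i ≤? K)
      where
      by-half : Dec (suc i ≤ K) → Adj G (p i) (p (suc i)) × TreeEdge (p i) (p (suc i))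
      by-half (yes si≤K) = subst₂ (Adj G) (sym (p-up (<⇒≤ si≤K))) (sym (p-up si≤K)) (ancestor-adj i<depth) ,
                           inj₁ (trans (p-up si≤K) (cong parent (sym (p-up (<⇒≤ si≤K)))))
        where
        i<depth : i < depth x
        i<depth = <-≤-trans si≤K (subst (K ≤_) (sym dx) K≤D)
      by-half (no si≰K) = subst₂ (Adj G) (sym here-up) (sym next-up) (adj-sym G (ancestor-adj m<depth)) ,
                          inj₂ (trans here-up (cong parent (sym next-up)))
        where
        m : ℕ
        m = T ∸ suc i
        m<K : m < K
        m<K = subst (m <_) T∸K (∸-monoʳ-< (≰⇒> si≰K) i<T)
        m<depth : m < depth y
        m<depth = <-≤-trans m<K (subst (K ≤_) (sym dy) K≤D)
        next-up : p (suc i) ≡ ancestor m y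
        next-up = p-down′ (≰⇒> si≰K) i<T
        here-up : p i ≡ ancestor (suc m) y
        here-up = trans (cong p (sym (trans (cong (T ∸_) (sym (+-∸-assoc 1 i<T))) (m∸[m∸n]≡n (<⇒≤ i<T))))) (p-down m<K)

    p-depth : ∀ i → i ≤ T → depth (p i) ≤ D
    p-depth i i≤T with position i i≤T
    ... | ascending i≤K = subst (_≤ D) (sym (trans (cong depth (p-up i≤K)) (depth-up i))) (m∸n≤m D i)
    ... | descending m m<K refl = subst (_≤ D) (sym (trans (cong depth (p-down (<⇒≤ m<K))) (depth-down m))) (m∸n≤m D m)

    p-first : p 0 ≡ x
    p-first = p-up z≤n
    p-second : p 1 ≡ parent x
    p-second = p-up (s≤s z≤n)
    p-last : p T ≡ y
    p-last = p-down z≤n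
    p-penultimate : p (T ∸ 1) ≡ parent y
    p-penultimate = p-down (s≤s z≤n)

  -- An edge s–t between vertices of equal depth closes the cycle
  -- t ⋯ (meeting point) ⋯ s, t.
  equal-depth-cycle : ∀ {s t} → Adj G s t → depth t ≡ depth s → FundamentalCycle s t
  equal-depth-cycle {s} {t} a dt≡ds with chains-meet t s dt≡ds (λ t≡s → adj-irrefl G a (sym t≡s))
  ... | k , meet , apart , K≤D = record
    { cycle = cycle
    ; on-s = subst (λ v → OnCycle v cycle) p-last (on-cycle T ≤-refl)
    ; on-t = subst (λ v → OnCycle v cycle) p-first (on-cycle 0 (s≤s z≤n))
    ; on-parent-s = subst (λ v → OnCycle v cycle) p-penultimate (on-cycle (T ∸ 1) (s≤s (m∸n≤m T 1)))
    ; on-parent-t = subst (λ v → OnCycle v cycle) p-second (on-cycle 1 (s≤s (s≤s z≤n)))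
    ; on-grandparent-s = λ e → ⊥-elim (1+n≢n (sym (trans dt≡ds e)))
    ; on-grandparent-t = λ e → ⊥-elim (1+n≢n (sym (trans (sym dt≡ds) e)))
    ; edge-st = subst₂ (CycleEdge cycle) p-last p-first closing-edge
    ; edges-tree-or-st = λ u v e → classify u v (edge-cases u v e)
    }
    where
    open TreePath t s t (depth t) refl (sym dt≡ds) k meet apart K≤D
    open CycleOfSequence G (k + k) p (λ i j i< j< → p-inj i j (s≤s⁻¹ i<) (s≤s⁻¹ j<))
           (λ i i<T → proj₁ (p-step i i<T)) (subst₂ (Adj G) (sym p-last) (sym p-first) a)
    classify : ∀ u v → (∃[ i ] (i < T × Pair (p i) (p (suc i)) u v)) ⊎ Pair (p T) (p 0) u v →
               TreeEdge u v ⊎ Pair s t u v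
    classify u v (inj₁ (i , i<T , pr)) = inj₁ (TreeEdge-pair pr (proj₂ (p-step i i<T)))
    classify u v (inj₂ pr) = inj₂ (subst₂ (λ a b → Pair a b u v) p-last p-first pr)

  -- An edge s–t with depth t = 1 + depth s and s ≠ parent t closes the
  -- cycle parent t ⋯ (meeting point) ⋯ s, t, parent t.
  next-depth-cycle : ∀ {s t} → Adj G s t → s ≢ parent t → depth t ≡ suc (depth s) → FundamentalCycle s t
  next-depth-cycle {s} {t} a s≢pt dt≡1+ds with chains-meet (parent t) s dpt≡ds (λ pt≡s → s≢pt (sym pt≡s))
    where
    dpt≡ds : depth (parent t) ≡ depth s
    dpt≡ds = trans (depth-parent t) (cong (_∸ 1) dt≡1+ds)
  ... | k , meet , apart , K≤D = record
    { cycle = cycle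
    ; on-s = subst (λ v → OnCycle v cycle) p-last (on-cycle T (m<n⇒m<1+n (n<1+n T)))
    ; on-t = subst (λ v → OnCycle v cycle) p-after-last (on-cycle (suc T) ≤-refl)
    ; on-parent-s = subst (λ v → OnCycle v cycle) p-penultimate (on-cycle (T ∸ 1) (s≤s (m≤n⇒m≤1+n (m∸n≤m T 1))))
    ; on-parent-t = subst (λ v → OnCycle v cycle) p-first (on-cycle 0 (s≤s z≤n))
    ; on-grandparent-s = λ e → ⊥-elim (n≢2+n (trans e (cong suc dt≡1+ds)))
    ; on-grandparent-t = λ _ → subst (λ v → OnCycle v cycle) p-second (on-cycle 1 (s≤s (s≤s z≤n)))
    ; edge-st = subst₂ (CycleEdge cycle) p-last p-after-last (step-edge T ≤-refl)
    ; edges-tree-or-st = λ u v e → classify u v (edge-cases u v e)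
    }
    where
    D : ℕ
    D = depth (parent t)
    ds≡D : depth s ≡ D
    ds≡D = trans (sym (cong (_∸ 1) dt≡1+ds)) (sym (depth-parent t))
    open TreePath (parent t) s t D refl ds≡D k meet apart K≤D
    p-after-last : p (suc T) ≡ t
    p-after-last = p-tail ≤-refl
    -- t is deeper than every vertex of the tree path
    t-off-path : ∀ i → i ≤ T → p i ≢ t
    t-off-path i i≤T p≡t = <-irrefl refl (subst (_≤ D) dt (p-depth i i≤T))
      where
      dt : depth (p i) ≡ suc D
      dt = trans (cong depth p≡t) (trans dt≡1+ds (cong suc ds≡D))
    extended-inj : ∀ i j → i < suc (suc T) → j < suc (suc T) → p i ≡ p j → i ≡ j
    extended-inj i j i< j< e with m≤n⇒m<n∨m≡n (s≤s⁻¹ i<) | m≤n⇒m<n∨m≡n (s≤s⁻¹ j<)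
    ... | inj₁ i≤T | inj₁ j≤T = p-inj i j (s≤s⁻¹ i≤T) (s≤s⁻¹ j≤T) e
    ... | inj₁ i≤T | inj₂ refl = ⊥-elim (t-off-path i (s≤s⁻¹ i≤T) (trans e p-after-last))
    ... | inj₂ refl | inj₁ j≤T = ⊥-elim (t-off-path j (s≤s⁻¹ j≤T) (trans (sym e) p-after-last))
    ... | inj₂ refl | inj₂ refl = refl
    t≢r : t ≢ r
    t≢r = depth>0⇒nonroot (subst (0 <_) (sym dt≡1+ds) (s≤s z≤n))
    extended-adj : ∀ i → i < suc T → Adj G (p i) (p (suc i))
    extended-adj i i< with m≤n⇒m<n∨m≡n (s≤s⁻¹ i<)
    ... | inj₁ i<T = proj₁ (p-step i i<T)
    ... | inj₂ refl = subst₂ (Adj G) (sym p-last) (sym p-after-last) a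
    open CycleOfSequence G (suc (k + k)) p extended-inj extended-adj
           (subst₂ (Adj G) (sym p-after-last) (sym p-first) (parent-adj t≢r))
    classify : ∀ u v → (∃[ i ] (i < suc T × Pair (p i) (p (suc i)) u v)) ⊎ Pair (p (suc T)) (p 0) u v →
               TreeEdge u v ⊎ Pair s t u v
    classify u v (inj₁ (i , i< , pr)) with m≤n⇒m<n∨m≡n (s≤s⁻¹ i<)
    ... | inj₁ i<T = inj₁ (TreeEdge-pair pr (proj₂ (p-step i i<T)))
    ... | inj₂ refl = inj₂ (subst₂ (λ a b → Pair a b u v) p-last p-after-last pr)
    classify u v (inj₂ pr) = inj₁ (TreeEdge-pair pr (inj₁ (trans p-first (cong parent (sym p-after-last)))))

  -- Every non-tree edge has a fundamental cycle.  Depths of adjacent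
  -- vertices differ by at most one, so the two constructions above cover
  -- all cases.
  fundamental-cycle : ∀ {s t} → NonTreeEdge s t → FundamentalCycle s t
  fundamental-cycle {s} {t} (a , s≢pt , t≢ps) with <-cmp (depth s) (depth t)
  ... | tri< lt _ _ = next-depth-cycle a s≢pt (≤-antisym (depth-adj a) lt)
  ... | tri≈ _ e _ = equal-depth-cycle a (sym e)
  ... | tri> _ _ gt = flip (next-depth-cycle (adj-sym G a) t≢ps (≤-antisym (depth-adj (adj-sym G a)) gt))

  -- In a cactus a tree edge y–parent y lies on the fundamental cycle of at
  -- most one non-tree edge: two such cycles share y and parent y, so they
  -- are the same cycle, whose only non-tree edge is then both s₁t₁ and s₂t₂.
  one-cycle-per-tree-edge : CactusCycles G → ∀ {s₁ t₁ s₂ t₂ y} →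
    NonTreeEdge s₁ t₁ → NonTreeEdge s₂ t₂ → (F₁ : FundamentalCycle s₁ t₁) (F₂ : FundamentalCycle s₂ t₂) →
    OnCycle y (FundamentalCycle.cycle F₁) → OnCycle (parent y) (FundamentalCycle.cycle F₁) →
    OnCycle y (FundamentalCycle.cycle F₂) → OnCycle (parent y) (FundamentalCycle.cycle F₂) →
    y ≢ parent y → Pair s₁ t₁ s₂ t₂
  one-cycle-per-tree-edge cactus {s₁} {t₁} {s₂} {t₂} {y} (_ , s₁≢pt₁ , t₁≢ps₁) _ F₁ F₂ y∈₁ py∈₁ y∈₂ py∈₂ y≢py
    with Pair? s₁ t₁ s₂ t₂
  ... | yes same = same
  ... | no different = ⊥-elim (y≢py (cactus (cycle F₁) (cycle F₂) distinct y (parent y) y∈₁ y∈₂ py∈₁ py∈₂))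
    where
    open FundamentalCycle
    -- s₁t₁ is an edge of the first cycle but neither a tree edge nor s₂t₂
    not-in-second : TreeEdge s₁ t₁ ⊎ Pair s₂ t₂ s₁ t₁ → ⊥
    not-in-second (inj₁ (inj₁ e)) = t₁≢ps₁ e
    not-in-second (inj₁ (inj₂ e)) = s₁≢pt₁ e
    not-in-second (inj₂ p) = different (Pair-sym p)
    distinct : ¬ SameCycle (cycle F₁) (cycle F₂)
    distinct same = not-in-second (edges-tree-or-st F₂ s₁ t₁ (proj₁ (same s₁ t₁) (edge-st F₁)))

module CactusColouring {n : ℕ} (G : Graph n) (conn : Connected G) (r : Fin n) (cactus : CactusCycles G)
                       (x₁ : Fin n) (depth-x₁ : BFSTree.depth G conn r x₁ ≡ 1) where
  open BFSTree G conn r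
  open FundamentalCycles G conn r

  x₁≢r : x₁ ≢ r
  x₁≢r x₁≡r = 1+n≢0 (trans (sym depth-x₁) (trans (cong depth x₁≡r) depth-root))

  r-adj-x₁ : Adj G r x₁
  r-adj-x₁ = adj-sym G (subst (Adj G x₁) (depth1⇒parent-root depth-x₁) (parent-adj x₁≢r))

  -- The designated neighbour of v: its parent, or x₁ for the root.  The
  -- colouring will make the colour of `designated v` unique in N(v).
  designated : Fin n → Fin n
  designated v with v ≟F r
  ... | yes _ = x₁
  ... | no _ = parent v

  designated-cases : ∀ v → (v ≡ r × designated v ≡ x₁) ⊎ (v ≢ r × designated v ≡ parent v)
  designated-cases v with v ≟F r
  ... | yes v≡r = inj₁ (v≡r , refl)
  ... | no v≢r = inj₂ (v≢r , refl)

  designated-adj : ∀ v → Adj G v (designated v)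
  designated-adj v with designated-cases v
  ... | inj₁ (refl , e) = subst (Adj G r) (sym e) r-adj-x₁
  ... | inj₂ (v≢r , e) = subst (Adj G v) (sym e) (parent-adj v≢r)

  -- The colouring order: by depth, ties broken by vertex index, with x₁
  -- first among the vertices of depth 1.
  tag : Fin n → ℕ
  tag v with v ≟F x₁
  ... | yes _ = 0
  ... | no _ = suc (toℕ v)

  N : ℕ
  N = suc n

  tag<N : ∀ v → tag v < N
  tag<N v with v ≟F x₁
  ... | yes _ = s≤s z≤n
  ... | no _ = s≤s (toℕ<n v)

  tag-inj : ∀ {u v} → tag u ≡ tag v → u ≡ v
  tag-inj {u} {v} e with u ≟F x₁ | v ≟F x₁
  ... | yes u≡x₁ | yes v≡x₁ = trans u≡x₁ (sym v≡x₁)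
  ... | yes _ | no _ = ⊥-elim (0≢1+n e)
  ... | no _ | yes _ = ⊥-elim (1+n≢0 e)
  ... | no _ | no _ = toℕ-injective (suc-injective e)

  tag-x₁ : tag x₁ ≡ 0
  tag-x₁ with x₁ ≟F x₁
  ... | yes _ = refl
  ... | no x₁≢x₁ = ⊥-elim (x₁≢x₁ refl)

  tag>0 : ∀ {v} → v ≢ x₁ → 0 < tag v
  tag>0 {v} v≢x₁ with v ≟F x₁
  ... | yes v≡x₁ = ⊥-elim (v≢x₁ v≡x₁)
  ... | no _ = s≤s z≤n

  rank : Fin n → ℕ
  rank v = depth v * N + tag v

  rank-depth : ∀ {z y} → depth z < depth y → rank z < rank y
  rank-depth {z} {y} lt = begin-strict
      depth z * N + tag z  <⟨ +-monoʳ-< (depth z * N) (tag<N z) ⟩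
      depth z * N + N      ≡⟨ +-comm (depth z * N) N ⟩
      suc (depth z) * N    ≤⟨ *-monoˡ-≤ N lt ⟩
      depth y * N          ≤⟨ m≤m+n (depth y * N) (tag y) ⟩
      rank y               ∎
    where open ≤-Reasoning

  rank⇒depth : ∀ {z y} → rank z < rank y → depth z ≤ depth y
  rank⇒depth lt = ≮⇒≥ (λ gt → <-asym lt (rank-depth gt))

  rank-inj : ∀ {z y} → rank z ≡ rank y → z ≡ y
  rank-inj {z} {y} e with <-cmp (depth z) (depth y)
  ... | tri< lt _ _ = ⊥-elim (<-irrefl e (rank-depth lt))
  ... | tri> _ _ gt = ⊥-elim (<-irrefl (sym e) (rank-depth gt))
  ... | tri≈ _ dz≡dy _ = tag-inj (+-cancelˡ-≡ (depth z * N) _ _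
                                    (subst (λ d → depth z * N + tag z ≡ d * N + tag y) (sym dz≡dy) e))

  x₁-first : ∀ {z} → depth z ≡ 1 → z ≢ x₁ → rank x₁ < rank z
  x₁-first {z} dz z≢x₁ = subst₂ _<_ (sym (cong₂ (λ d t → d * N + t) depth-x₁ tag-x₁))
                                    (sym (cong (λ d → d * N + tag z) dz))
                                    (+-monoʳ-< (1 * N) (tag>0 z≢x₁))

  -- z conflicts with w when z is a neighbour of some v whose designated
  -- neighbour is w ≠ z: then z and w must receive different colours.
  Conflict : Fin n → Fin n → Set
  Conflict z w = ∃[ v ] (Adj G v z × w ≡ designated v × z ≢ w)

  Conflict? : ∀ z w → Dec (Conflict z w)
  Conflict? z w = any? (λ v → Adj? G v z ×-dec ((w ≟F designated v) ×-dec ¬? (z ≟F w)))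

  Conflicting : Fin n → Fin n → Set
  Conflicting z y = Conflict z y ⊎ Conflict y z

  -- One earlier partner of y is always its grandparent (x₁ near the root).
  grandparent : Fin n → Fin n
  grandparent y with 2 ≤? depth y
  ... | yes _ = parent (parent y)
  ... | no _ = x₁

  grandparent-cases : ∀ y → (2 ≤ depth y × grandparent y ≡ parent (parent y)) ⊎ (depth y < 2 × grandparent y ≡ x₁)
  grandparent-cases y with 2 ≤? depth y
  ... | yes 2≤d = inj₁ (2≤d , refl)
  ... | no 2≰d = inj₂ (≰⇒> 2≰d , refl)

  -- Any other earlier conflict of y comes from a non-tree edge: either y
  -- has a non-tree neighbour w with parent z, or y has a child b with a
  -- non-tree neighbour z one level up.
  data OtherConflict (y z : Fin n) : Set where
    via-neighbour : ∀ w → NonTreeEdge y w → z ≡ parent w → OtherConflict y z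
    via-child : ∀ b → NonTreeEdge b z → depth b ≡ suc (depth z) → y ≡ parent b → OtherConflict y z

  -- Case Conflict z y: y is the parent of a vertex v adjacent to z.
  classify-designated : ∀ {y z} → rank z < rank y → Conflict z y → OtherConflict y z
  classify-designated {y} {z} z<y (v , a , y≡dv , z≢y) with designated-cases v
  ... | inj₁ (refl , dv≡x₁) = ⊥-elim (<-asym z<y (subst (λ u → rank u < rank z) (sym y≡x₁)
                                       (x₁-first (root-neighbour-depth a) (λ z≡x₁ → z≢y (trans z≡x₁ (sym y≡x₁))))))
    where
    y≡x₁ : y ≡ x₁
    y≡x₁ = trans y≡dv dv≡x₁
  ... | inj₂ (v≢r , dv≡pv) = via-child v (a , v≢pz , λ z≡pv → z≢y (trans z≡pv (sym y≡pv))) dv≡1+dz y≡pv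
    where
    y≡pv : y ≡ parent v
    y≡pv = trans y≡dv dv≡pv
    1+dy≡dv : suc (depth y) ≡ depth v
    1+dy≡dv = trans (cong (λ u → suc (depth u)) y≡pv) (proj₂ (parent-spec v≢r))
    dv≡1+dz : depth v ≡ suc (depth z)
    dv≡1+dz = ≤-antisym (depth-adj (adj-sym G a)) (subst (suc (depth z) ≤_) 1+dy≡dv (s≤s (rank⇒depth z<y)))
    v≢pz : v ≢ parent z
    v≢pz v≡pz = <-irrefl refl (subst (_≤ depth z) dv≡1+dz
                  (subst (_≤ depth z) (sym (trans (cong depth v≡pz) (depth-parent z))) (m∸n≤m (depth z) 1)))

  -- Case Conflict y z: z is the designated neighbour of a neighbour v of y.
  classify-neighbour : ∀ {y z} → Conflict y z → z ≢ grandparent y → OtherConflict y z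
  classify-neighbour {y} {z} (v , a , z≡dv , y≢z) z≢gy with designated-cases v
  ... | inj₁ (refl , dv≡x₁) = ⊥-elim (z≢gy (trans (trans z≡dv dv≡x₁) (sym gy≡x₁)))
    where
    gy≡x₁ : grandparent y ≡ x₁
    gy≡x₁ with grandparent-cases y
    ... | inj₁ (2≤dy , _) = ⊥-elim (<-irrefl refl (subst (2 ≤_) (root-neighbour-depth a) 2≤dy))
    ... | inj₂ (_ , e) = e
  ... | inj₂ (v≢r , dv≡pv) with v ≟F parent y
  ...   | yes v≡py = ⊥-elim (z≢gy (trans (trans z≡dv dv≡pv) (sym gy≡pv)))
    where
    y≢r : y ≢ r
    y≢r y≡r = v≢r (trans v≡py (trans (cong parent y≡r) parent-root))
    2≤dy : 2 ≤ depth y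
    2≤dy = subst (2 ≤_) (trans (cong (λ u → suc (depth u)) v≡py) (proj₂ (parent-spec y≢r))) (s≤s (nonroot⇒depth>0 v≢r))
    gy≡pv : grandparent y ≡ parent v
    gy≡pv with grandparent-cases y
    ... | inj₁ (_ , e) = trans e (cong parent (sym v≡py))
    ... | inj₂ (dy<2 , _) = ⊥-elim (<-irrefl refl (<-≤-trans dy<2 2≤dy))
  ...   | no v≢py = via-neighbour v (adj-sym G a , (λ y≡pv → y≢z (trans y≡pv (sym (trans z≡dv dv≡pv)))) , v≢py)
                      (trans z≡dv dv≡pv)

  classify : ∀ {y z} → rank z < rank y → Conflicting z y → z ≢ grandparent y → OtherConflict y z
  classify z<y (inj₁ c) _ = classify-designated z<y c
  classify _ (inj₂ c) z≢gy = classify-neighbour c z≢gy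

  other-conflict-nonroot : ∀ {y z} → OtherConflict y z → y ≢ r
  other-conflict-nonroot (via-neighbour w (a , y≢pw , _) _) refl = y≢pw (sym (depth1⇒parent-root (root-neighbour-depth a)))
  other-conflict-nonroot {y} {z} (via-child b (_ , _ , z≢pb) db≡1+dz y≡pb) refl = z≢pb (trans z≡r y≡pb)
    where
    z≡r : z ≡ r
    z≡r = depth0⇒root (trans (sym (trans (depth-parent b) (cong (_∸ 1) db≡1+dz))) (trans (cong depth (sym y≡pb)) depth-root))

  -- The non-tree edge s–t responsible for an other conflict of y; its
  -- fundamental cycle passes through the tree edge y–parent y.
  responsible-s responsible-t : ∀ {y z} → OtherConflict y z → Fin n
  responsible-s {y} (via-neighbour _ _ _) = y
  responsible-s (via-child b _ _ _) = b
  responsible-t (via-neighbour w _ _) = w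
  responsible-t {z = z} (via-child _ _ _ _) = z

  responsible-non-tree : ∀ {y z} (c : OtherConflict y z) → NonTreeEdge (responsible-s c) (responsible-t c)
  responsible-non-tree (via-neighbour _ nt _) = nt
  responsible-non-tree (via-child _ nt _ _) = nt

  responsible-cycle : ∀ {y z} (c : OtherConflict y z) → FundamentalCycle (responsible-s c) (responsible-t c)
  responsible-cycle c = fundamental-cycle (responsible-non-tree c)

  through-tree-edge : ∀ {y z} (c : OtherConflict y z) →
    OnCycle y (FundamentalCycle.cycle (responsible-cycle c)) × OnCycle (parent y) (FundamentalCycle.cycle (responsible-cycle c))
  through-tree-edge (via-neighbour _ nt _) = on-s , on-parent-s
    where open FundamentalCycle (fundamental-cycle nt)
  through-tree-edge (via-child _ nt db≡1+dz refl) = on-parent-s , on-grandparent-s db≡1+dz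
    where open FundamentalCycle (fundamental-cycle nt)

  -- By the cactus property all other conflicts of y share the responsible edge.
  same-responsible-edge : ∀ {y z₁ z₂} (c₁ : OtherConflict y z₁) (c₂ : OtherConflict y z₂) →
    Pair (responsible-s c₁) (responsible-t c₁) (responsible-s c₂) (responsible-t c₂)
  same-responsible-edge c₁ c₂ =
    one-cycle-per-tree-edge cactus (responsible-non-tree c₁) (responsible-non-tree c₂)
      (responsible-cycle c₁) (responsible-cycle c₂)
      (proj₁ (through-tree-edge c₁)) (proj₂ (through-tree-edge c₁))
      (proj₁ (through-tree-edge c₂)) (proj₂ (through-tree-edge c₂))
      (nonroot⇒≢parent (other-conflict-nonroot c₁))

  neighbour-not-child : ∀ {y w b z} → NonTreeEdge b z → y ≡ parent b → y ≢ r → ¬ Pair y w b z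
  neighbour-not-child _ y≡pb y≢r (inj₁ (refl , _)) = nonroot⇒≢parent y≢r y≡pb
  neighbour-not-child (_ , _ , z≢pb) y≡pb _ (inj₂ (refl , _)) = z≢pb y≡pb

  other-conflict-unique : ∀ {y z₁ z₂} → OtherConflict y z₁ → OtherConflict y z₂ → z₁ ≡ z₂
  other-conflict-unique c₁ c₂ = from-edge c₁ c₂ (same-responsible-edge c₁ c₂)
    where
    from-edge : ∀ {y z₁ z₂} (c₁ : OtherConflict y z₁) (c₂ : OtherConflict y z₂) →
      Pair (responsible-s c₁) (responsible-t c₁) (responsible-s c₂) (responsible-t c₂) → z₁ ≡ z₂
    from-edge (via-neighbour _ _ refl) (via-neighbour _ _ refl) (inj₁ (_ , refl)) = refl
    from-edge (via-neighbour _ _ _) (via-neighbour _ (a , _) _) (inj₂ (refl , _)) = ⊥-elim (adj-irrefl G a refl)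
    from-edge c₁@(via-neighbour _ _ _) (via-child _ nt _ y≡pb) e =
      ⊥-elim (neighbour-not-child nt y≡pb (other-conflict-nonroot c₁) e)
    from-edge (via-child _ nt _ y≡pb) c₂@(via-neighbour _ _ _) e =
      ⊥-elim (neighbour-not-child nt y≡pb (other-conflict-nonroot c₂) (Pair-sym e))
    from-edge (via-child _ _ _ _) (via-child _ _ _ _) (inj₁ (_ , z₁≡z₂)) = z₁≡z₂
    from-edge (via-child b₁ _ db₁ _) (via-child b₂ _ db₂ _) (inj₂ (b₁≡z₂ , z₁≡b₂)) =
      ⊥-elim (n≢2+n (trans (cong depth (sym b₁≡z₂)) (trans db₁ (cong suc (trans (cong depth z₁≡b₂) db₂)))))

  OtherEarlier : Fin n → Fin n → Set
  OtherEarlier y z = rank z < rank y × Conflicting z y × z ≢ grandparent y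

  OtherEarlier? : ∀ y z → Dec (OtherEarlier y z)
  OtherEarlier? y z = (rank z <? rank y) ×-dec ((Conflict? z y ⊎-dec Conflict? y z) ×-dec ¬? (z ≟F grandparent y))

  second-partner : Fin n → Fin n
  second-partner y with any? (OtherEarlier? y)
  ... | yes (z , _) = z
  ... | no _ = y

  second-partner-spec : ∀ y z → OtherEarlier y z → z ≡ second-partner y
  second-partner-spec y z (z<y , c , z≢gy) with any? (OtherEarlier? y)
  ... | yes (z′ , (z′<y , c′ , z′≢gy)) = other-conflict-unique (classify z<y c z≢gy) (classify z′<y c′ z′≢gy)
  ... | no none = ⊥-elim (none (z , z<y , c , z≢gy))

  earlier-partners : ∀ y z → rank z < rank y → Conflicting z y → z ≡ grandparent y ⊎ z ≡ second-partner y
  earlier-partners y z z<y c with z ≟F grandparent y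
  ... | yes z≡gy = inj₁ z≡gy
  ... | no z≢gy = inj₂ (second-partner-spec y z (z<y , c , z≢gy))

  open Greedy rank grandparent second-partner public using (colour; proper)

  conflict-proper : ∀ {z w} → Conflict z w → colour z ≢ colour w
  conflict-proper {z} {w} c@(_ , _ , _ , z≢w) with <-cmp (rank z) (rank w)
  ... | tri< z<w _ _ = proper w z z<w (earlier-partners w z z<w (inj₁ c))
  ... | tri> _ _ w<z = proper z w w<z (earlier-partners z w w<z (inj₂ c)) ∘ sym
  ... | tri≈ _ z≡w _ = ⊥-elim (z≢w (rank-inj z≡w))

  conflict-free : IsCFColoring G colour
  conflict-free v = colour (designated v) , designated v , designated-adj v , refl , unique
    where
    unique : ∀ w → Adj G v w → colour w ≡ colour (designated v) → w ≡ designated v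
    unique w a same with w ≟F designated v
    ... | yes w≡dv = w≡dv
    ... | no w≢dv = ⊥-elim (conflict-proper (v , a , refl , w≢dv) same)

-- Part 1.  A connected graph with a second vertex v ≠ r has a vertex at
-- depth 1 (an ancestor of v), so the construction above applies.
depth-one-vertex : ∀ {n} (G : Graph n) (conn : Connected G) (r v : Fin n) → v ≢ r →
  ∃[ x₁ ] BFSTree.depth G conn r x₁ ≡ 1
depth-one-vertex G conn r v v≢r = ancestor (depth v ∸ 1) v ,
  trans (depth-ancestor (depth v ∸ 1) v) (m∸[m∸n]≡n (nonroot⇒depth>0 v≢r))
  where open BFSTree G conn r

cactus-colourable : ∀ (n : ℕ) (G : Graph n) → 2 ≤ n → Cactus G → CFColorable G 3
cactus-colourable zero G () _
cactus-colourable (suc zero) G (s≤s ()) _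
cactus-colourable (suc (suc m)) G _ (conn , cycles) with depth-one-vertex G conn fz (fs fz) (λ ())
... | x₁ , depth-x₁ = colour , conflict-free
  where open CactusColouring G conn fz cycles x₁ depth-x₁

complete : ∀ n → Graph n
complete n = record { adj = λ u v → not (does (u ≟F v)) ; sym = symmetric ; irref = irreflexive }
  where
  symmetric : ∀ u v → not (does (u ≟F v)) ≡ not (does (v ≟F u))
  symmetric u v with u ≟F v | v ≟F u
  ... | yes _ | yes _ = refl
  ... | no _ | no _ = refl
  ... | yes u≡v | no v≢u = ⊥-elim (v≢u (sym u≡v))
  ... | no u≢v | yes v≡u = ⊥-elim (u≢v (sym v≡u))
  irreflexive : ∀ v → not (does (v ≟F v)) ≡ false
  irreflexive v with v ≟F v
  ... | yes _ = refl
  ... | no v≢v = ⊥-elim (v≢v refl)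

complete-adj : ∀ {n} {u v : Fin n} → u ≢ v → Adj (complete n) u v
complete-adj {u = u} {v} u≢v with u ≟F v
... | yes u≡v = ⊥-elim (u≢v u≡v)
... | no _ = refl

complete-connected : ∀ n → Connected (complete n)
complete-connected n u v with u ≟F v
... | yes refl = here
... | no u≢v = step (complete-adj u≢v) here

cycle-edge-distinct : ∀ {n} {G : Graph n} (C : Cycle G) {u v} → CycleEdge C u v → u ≢ v
cycle-edge-distinct {G = G} C (i , inj₁ (refl , refl)) = adj-irrefl G (edges C i)
cycle-edge-distinct {G = G} C (i , inj₂ (refl , refl)) = adj-irrefl G (edges C i) ∘ sym

-- In the triangle every cycle visits all three vertices, so it contains
-- every edge; hence all cycles coincide and the triangle is a cactus.
triangle : Graph 3
triangle = complete 3

third-unique : ∀ (a b c : Fin 3) → a ≢ b → b ≢ c → a ≢ c → c ≡ third a b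
third-unique = toWitness {a? = all? λ a → all? λ b → all? λ c →
  ¬? (a ≟F b) →-dec ¬? (b ≟F c) →-dec ¬? (a ≟F c) →-dec (c ≟F third a b)} tt

three-pairs : ∀ (a b u v : Fin 3) → a ≢ b → u ≢ v →
  Pair a b u v ⊎ Pair b (third a b) u v ⊎ Pair (third a b) a u v
three-pairs = toWitness {a? = all? λ a → all? λ b → all? λ u → all? λ v →
  ¬? (a ≟F b) →-dec ¬? (u ≟F v) →-dec
  (Pair? a b u v ⊎-dec Pair? b (third a b) u v ⊎-dec Pair? (third a b) a u v)} tt

module TriangleCycle (C : Cycle triangle) where
  length-three : len C ≡ 0
  length-three = short (len C) (vert C) (inj C)
    where
    short : ∀ l (f : Fin (suc (suc (suc l))) → Fin 3) → (∀ i j → f i ≡ f j → i ≡ j) → l ≡ 0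
    short zero f f-inj = refl
    short (suc l) f f-inj with pigeonhole (s≤s (s≤s (s≤s (s≤s z≤n)))) f
    ... | i , j , i<j , fi≡fj = ⊥-elim (<-irrefl (cong toℕ (f-inj i j fi≡fj)) i<j)

  i₀ i₁ i₂ : Fin (suc (suc (suc (len C))))
  i₀ = fz
  i₁ = fs fz
  i₂ = fs (fs fz)

  next₀ : next i₀ ≡ i₁
  next₀ with next-cases i₀
  ... | inj₁ (_ , e) = toℕ-injective e
  ... | inj₂ (() , _)

  next₁ : next i₁ ≡ i₂
  next₁ with next-cases i₁
  ... | inj₁ (_ , e) = toℕ-injective e
  ... | inj₂ (() , _)

  next₂ : next i₂ ≡ i₀
  next₂ with next-cases i₂
  ... | inj₁ (lt , _) = ⊥-elim (<-irrefl refl (subst (λ l → 3 < suc (suc (suc l))) length-three lt))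
  ... | inj₂ (_ , e) = toℕ-injective e

  consecutive-edge : ∀ {i j u v} → next i ≡ j → Pair (vert C i) (vert C j) u v → CycleEdge C u v
  consecutive-edge {i} refl (inj₁ p) = i , inj₁ p
  consecutive-edge {i} refl (inj₂ p) = i , inj₂ p

  distinct-vertices : ∀ {i j} → i ≢ j → vert C i ≢ vert C j
  distinct-vertices {i} {j} i≢j = i≢j ∘ inj C i j

  third-vertex : vert C i₂ ≡ third (vert C i₀) (vert C i₁)
  third-vertex = third-unique _ _ _ (distinct-vertices λ ()) (distinct-vertices λ ()) (distinct-vertices λ ())

  all-edges : ∀ u v → u ≢ v → CycleEdge C u v
  all-edges u v u≢v with three-pairs (vert C i₀) (vert C i₁) u v (distinct-vertices λ ()) u≢v
  ... | inj₁ p = consecutive-edge next₀ p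
  ... | inj₂ (inj₁ p) = consecutive-edge next₁ (subst (λ c → Pair (vert C i₁) c u v) (sym third-vertex) p)
  ... | inj₂ (inj₂ p) = consecutive-edge next₂ (subst (λ c → Pair c (vert C i₀) u v) (sym third-vertex) p)

triangle-cactus : Cactus triangle
triangle-cactus = complete-connected 3 , λ C D different → ⊥-elim (different (same C D))
  where
  same : ∀ C D → SameCycle C D
  same C D u v = (λ e → TriangleCycle.all-edges D u v (cycle-edge-distinct C e))
               , (λ e → TriangleCycle.all-edges C u v (cycle-edge-distinct D e))

-- In a complete conflict-free colouring, the two neighbours of a vertex of
-- degree two get different colours (else no colour occurs once in N(v)).
degree-two-distinct : ∀ {n k} (G : Graph n) (c : Fin n → Fin k) → IsCFColoring G c →
  ∀ v u w → Adj G v u → Adj G v w → u ≢ w → (∀ x → Adj G v x → x ≡ u ⊎ x ≡ w) → c u ≢ c w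
degree-two-distinct G c cf v u w vu vw u≢w only cu≡cw with cf v
... | col , x , vx , cx≡col , unique with only x vx
...   | inj₁ refl = u≢w (sym (unique w vw (trans (sym cu≡cw) cx≡col)))
...   | inj₂ refl = u≢w (unique u vu (trans cu≡cw cx≡col))

triangle-neighbourhood : ∀ (u w : Fin 3) → u ≢ w → ∀ x → x ≢ third u w → x ≡ u ⊎ x ≡ w
triangle-neighbourhood = toWitness {a? = all? λ u → all? λ w → ¬? (u ≟F w) →-dec all? λ x →
  ¬? (x ≟F third u w) →-dec ((x ≟F u) ⊎-dec (x ≟F w))} tt

-- So a conflict-free colouring of the triangle is injective, and needs 3 colours.
triangle-needs-three : ∀ j → j < 3 → ¬ CFColorable triangle j
triangle-needs-three j j<3 (c , cf) with pigeonhole j<3 c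
... | u , w , u<w , cu≡cw = degree-two-distinct triangle c cf (third u w) u w
        (complete-adj (proj₁ (third-avoids u w))) (complete-adj (proj₂ (third-avoids u w))) u≢w
        (λ x a → triangle-neighbourhood u w u≢w x (λ x≡t → adj-irrefl triangle a (sym x≡t))) cu≡cw
  where
  u≢w : u ≢ w
  u≢w u≡w = <-irrefl (cong toℕ u≡w) u<w

-- The identity colouring: every vertex sees two distinct colours once each.
triangle-colourable : CFColorable triangle 3
triangle-colourable = (λ v → v) , λ v → third v v , third v v ,
  complete-adj (λ e → proj₁ (third-avoids v v) (sym e)) , refl , λ _ _ e → e

theorem4 : (∀ (n : ℕ) (G : Graph n) → 2 ≤ n → Cactus G → CFColorable G 3)
    × (∃[ n ] Σ (Graph n) (λ G → Cactus G × χCF≡ G 3))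
theorem4 = cactus-colourable , 3 , triangle , triangle-cactus , triangle-colourable , triangle-needs-three
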